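{- Let $w = w_1\dots w_n$ be an area sequence of size $n \ge 1$, let $b_1 \dots b_n$ be its bounce sequence, and let $\mathrm{bounces}(w) = \{ i > 1 : b_i = 0\}$. Then: (1) if $n \ge 2$, then $b_n = 0$ if and only if $\max(\psi(w)) = \max(\psi(u)) + 1$, where $u = w_1 \dots w_{n-1}$; (2) $|\mathrm{bounces}(w)| = \max(\psi(w))$; (3) $|\mathrm{Maxb}(\psi(w))| = b_n + 1$; (4) $|\mathrm{Maxa}(\psi(w))| = w_n - b_n$. Moreover, for each $1 \le k \le \max(\psi(w))$, if $i$ is the $k$-th smallest element of $\mathrm{bounces}(w)$, then the number of letters of $\psi(w)$ with value $\ge k$ equals $n - i + 1$.
   Context: An area sequence of size $n$ is a word $w = w_1 \dots w_n$ of nonnegative integers with $w_1 = 0$ and $0 \le w_{i+1} \le w_i + 1$ for $1 \le i < n$; the empty word $\varepsilon$ is the area sequence of size $0$. Bounce sequence: $b_1 = 0$ and for $i \ge 2$, $b_i = b_{i-1}+1$ if $b_{i-1}+1 \le w_i$, and $b_i = 0$ otherwise. Insertion: $\operatorname{ins}_0(w) := 0 w_1 \dots w_n$, and for $1 \le i \le n$, $\operatorname{ins}_i(w) := w_1 \dots w_i (w_i+1) w_{i+1} \dots w_n$. For a nonempty area sequence $v$ with maximum value $m$: $\mathrm{Maxb}(v) = \{ i : v_i = m\}$; $\mathrm{Maxa}(v)$ is the set of positions $i$ with $v_i = m-1$ and $v_j < m$ for all $j > i$; $i_0(v)$ is the position of the leftmost letter of the rightmost block of consecutive letters equal to $m$.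 The admissible insertion positions of $v$ are $\mathrm{Maxb}(v) \cup \mathrm{Maxa}(v) \cup \{i_0(v) - 1\}$, in admissible order: elements of $\mathrm{Maxb}(v)$ decreasing, then elements of $\mathrm{Maxa}(v)$ decreasing, then $i_0(v)-1$. For the empty word, the only admissible insertion position is $0$. The map $\psi$: $\psi(\varepsilon) = \varepsilon$, and for $w = ua$ with last letter $a$, $\psi(w) = \operatorname{ins}_{c_a}(\psi(u))$ where $c_0, \dots, c_k$ are the admissible insertion positions of $\psi(u)$ in admissible order ($\psi$ maps area sequences of size $n$ to area sequences of size $n$). -}

module Defs where

open import Data.Nat using (ℕ; zero; suc; _+_; _∸_; _≤_; _<_; _⊔_; _≟_; _≤?_; _<?_; _≡ᵇ_)
open import Data.Bool using (if_then_else_)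
open import Data.List using (List; []; _∷_; _++_; [_]; length; filter; map; upTo; reverse; take; drop; foldr)
open import Data.List.Relation.Unary.All using (all?)
open import Data.Product using (_×_)
open import Relation.Binary.PropositionalEquality using (_≡_)
open import Relation.Nullary using (yes; no)
open import Relation.Nullary.Decidable using (_×-dec_)
open import Data.Unit using (⊤)

-- Words are lists of naturals; positions are 1-indexed.

-- i-th letter (1-indexed), default 0 outside 1..length
nth : List ℕ → ℕ → ℕ
nth [] _ = 0
nth (x ∷ xs) zero = 0
nth (x ∷ xs) (suc zero) = x
nth (x ∷ xs) (suc (suc i)) = nth xs (suc i)

-- 0-indexed lookup with default 0 (used for c_a, a = 0,1,...)
lookup0 : List ℕ → ℕ → ℕ
lookup0 [] _ = 0
lookup0 (x ∷ xs) zero = x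
lookup0 (x ∷ xs) (suc i) = lookup0 xs i

positions : List ℕ → List ℕ
positions v = map suc (upTo (length v))

Steps : List ℕ → Set
Steps (x ∷ y ∷ r) = (y ≤ suc x) × Steps (y ∷ r)
Steps _ = ⊤

IsAreaSeq : List ℕ → Set
IsAreaSeq [] = ⊤
IsAreaSeq (x ∷ r) = (x ≡ 0) × Steps (x ∷ r)

bounceGo : ℕ → List ℕ → List ℕ
bounceGo prev [] = []
bounceGo prev (x ∷ xs) with suc prev ≤? x
... | yes _ = suc prev ∷ bounceGo (suc prev) xs
... | no _ = 0 ∷ bounceGo 0 xs

bounce : List ℕ → List ℕ
bounce [] = []
bounce (x ∷ xs) = 0 ∷ bounceGo 0 xs

bounces : List ℕ → List ℕ
bounces w = filter (λ i → (2 ≤? i) ×-dec (nth (bounce w) i ≟ 0)) (positions w)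

ins : ℕ → List ℕ → List ℕ
ins zero w = 0 ∷ w
ins (suc i) w = take (suc i) w ++ (suc (nth w (suc i)) ∷ drop (suc i) w)

maxw : List ℕ → ℕ
maxw = foldr _⊔_ 0

Maxb : List ℕ → List ℕ
Maxb v = filter (λ i → nth v i ≟ maxw v) (positions v)

Maxa : List ℕ → List ℕ
Maxa v = filter (λ i → (suc (nth v i) ≟ maxw v)
                        ×-dec all? (λ j → nth v j <? maxw v) (drop i (positions v)))
                (positions v)

blockStart : List ℕ → ℕ → ℕ
blockStart v zero = zero
blockStart v (suc zero) = suc zero
blockStart v (suc (suc p)) =
  if nth v (suc p) ≡ᵇ maxw v then blockStart v (suc p) else suc (suc p)

i0 : List ℕ → ℕ
i0 v = blockStart v (foldr _⊔_ 0 (Maxb v))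

admissible : List ℕ → List ℕ
admissible [] = 0 ∷ []
admissible v@(_ ∷ _) = reverse (Maxb v) ++ reverse (Maxa v) ++ [ i0 v ∸ 1 ]

ψrev : List ℕ → List ℕ
ψrev [] = []
ψrev (a ∷ r) = ins (lookup0 (admissible (ψrev r)) a) (ψrev r)

ψ : List ℕ → List ℕ
ψ w = ψrev (reverse w)

countGE : ℕ → List ℕ → ℕ
countGE k v = length (filter (λ x → k ≤? x) v)

-- Let u have last letter a' and last bounce β, and
-- let v = ψ(u) have maximum m. The invariant is: v is an area sequence,
-- m = |bounces(u)|, |Maxb(v)| = β + 1, |Maxa(v)| = a' - β, and the letters
-- of v that are ≥ k are exactly as many as the positions from the k-th bounce on.
-- Appending a ≤ a' + 1, the admissible list has a' + 2 entries. If a ≤ β, the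
-- letter m + 1 goes right after the (a+1)-th rightmost maximal letter: a new
-- maximum with exactly a copies of m to its right (the new Maxa), while the bounce
-- restarts at 0. Otherwise a copy of m goes after a Maxa position (or before the
-- rightmost block of m's when a = a' + 1): the maximum is unchanged, Maxb grows
-- by one, the Maxa positions to its left are lost, and the bounce climbs to β + 1.

module Submission where

open import Defs
open import Data.Bool using (Bool; true; false; _∧_; if_then_else_; T)
open import Data.Bool.Properties using (∧-zeroʳ; ∧-identityʳ)
open import Data.Empty using (⊥-elim)
open import Data.List using (List; []; _∷_; _++_; [_]; length; filter; map; upTo; reverse; take; drop; foldr; _∷ʳ_)
open import Data.List.Properties
open import Data.List.Relation.Unary.All as All using (All; []; _∷_; all?)
open import Data.List.Relation.Unary.All.Properties using (map⁺; ++⁻ʳ; all-filter; filter⁺)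
open import Data.List.Relation.Unary.Any using (Any; here; there)
open import Data.List.Relation.Unary.Any.Properties using (++⁺ʳ)
open import Data.List.Reverse using (Reverse; reverseView; []; _∶_∶ʳ_)
open import Data.Nat using (ℕ; zero; suc; _+_; _∸_; _≤_; _<_; _⊔_; _≟_; _≤?_; _<?_; z≤n; s≤s; _≡ᵇ_)
open import Data.Nat.Properties
open import Data.Product using (_×_; _,_; proj₂)
open import Data.Sum using (inj₁; inj₂)
open import Data.Unit using (tt)
open import Function.Base using (_∘_)
open import Function.Bundles using (_⇔_; mk⇔)
open import Relation.Binary.PropositionalEquality hiding ([_])
open import Relation.Nullary using (¬_; does; Dec; yes; no)
open import Relation.Nullary.Decidable using (dec-true; dec-false; _×-dec_)
open import Relation.Unary using (Decidable)

-- Area sequences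

Steps-∷ʳ⁻ : ∀ xs (a : ℕ) → Steps (xs ∷ʳ a) → Steps xs
Steps-∷ʳ⁻ [] a _ = tt
Steps-∷ʳ⁻ (x ∷ []) a _ = tt
Steps-∷ʳ⁻ (x ∷ y ∷ r) a (le , st) = le , Steps-∷ʳ⁻ (y ∷ r) a st

IsAreaSeq-∷ʳ⁻ : ∀ w a → IsAreaSeq (w ∷ʳ a) → IsAreaSeq w
IsAreaSeq-∷ʳ⁻ [] a _ = tt
IsAreaSeq-∷ʳ⁻ (x ∷ r) a (x≡0 , st) = x≡0 , Steps-∷ʳ⁻ (x ∷ r) a st

Steps-last : ∀ u (a' a : ℕ) → Steps ((u ∷ʳ a') ∷ʳ a) → a ≤ suc a'
Steps-last [] a' a (le , _) = le
Steps-last (x ∷ []) a' a (_ , st) = Steps-last [] a' a st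
Steps-last (x ∷ y ∷ u) a' a (_ , st) = Steps-last (y ∷ u) a' a st

IsAreaSeq-last : ∀ u (a' a : ℕ) → IsAreaSeq ((u ∷ʳ a') ∷ʳ a) → a ≤ suc a'
IsAreaSeq-last [] a' a (_ , st) = Steps-last [] a' a st
IsAreaSeq-last (x ∷ u) a' a (_ , st) = Steps-last (x ∷ u) a' a st

Steps-nth : ∀ v → Steps v → ∀ k → nth v (suc (suc k)) ≤ suc (nth v (suc k))
Steps-nth [] _ k = z≤n
Steps-nth (x ∷ []) _ k = z≤n
Steps-nth (x ∷ y ∷ r) (le , st) zero = le
Steps-nth (x ∷ y ∷ r) (le , st) (suc k) = Steps-nth (y ∷ r) st k

Steps-raise-head : ∀ x r → Steps (x ∷ r) → Steps (suc x ∷ r)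
Steps-raise-head x [] _ = tt
Steps-raise-head x (y ∷ r) (le , st) = ≤-trans le (n≤1+n _) , st

Steps-ins : ∀ x r k → Steps (x ∷ r) →
  Steps (x ∷ (take k r ++ suc (nth (x ∷ r) (suc k)) ∷ drop k r))
Steps-ins x r zero st = ≤-refl , Steps-raise-head x r st
Steps-ins x [] (suc k) st = s≤s z≤n , tt
Steps-ins x (y ∷ r) (suc k) (le , st) = le , Steps-ins y r k st

ins-IsAreaSeq : ∀ i x r → IsAreaSeq (x ∷ r) → IsAreaSeq (ins i (x ∷ r))
ins-IsAreaSeq zero x r (refl , st) = refl , z≤n , st
ins-IsAreaSeq (suc k) x r (refl , st) = refl , Steps-ins x r k st

length-∷ʳ : ∀ (w : List ℕ) a → length (w ∷ʳ a) ≡ suc (length w)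
length-∷ʳ [] a = refl
length-∷ʳ (x ∷ w) a = cong suc (length-∷ʳ w a)

positions-∷ : ∀ x r → positions (x ∷ r) ≡ 1 ∷ map suc (positions r)
positions-∷ x r = cong (λ z → 1 ∷ map suc z) (sym (map-upTo suc (length r)))

positions-∷ʳ : ∀ w a → positions (w ∷ʳ a) ≡ positions w ∷ʳ suc (length w)
positions-∷ʳ w a = begin
  map suc (upTo (length (w ∷ʳ a)))        ≡⟨ cong (λ n → map suc (upTo n)) (length-∷ʳ w a) ⟩
  map suc (upTo (suc (length w)))         ≡⟨ cong (map suc) (sym (applyUpTo-∷ʳ (λ i → i) (length w))) ⟩
  map suc (upTo (length w) ∷ʳ length w)   ≡⟨ map-++ suc (upTo (length w)) [ length w ] ⟩
  positions w ∷ʳ suc (length w)           ∎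
  where open ≡-Reasoning

positions-bounds : ∀ v → All (λ i → 1 ≤ i × i ≤ length v) (positions v)
positions-bounds [] = []
positions-bounds (x ∷ r) rewrite positions-∷ x r =
  (s≤s z≤n , s≤s z≤n) ∷ map⁺ (All.map (λ (_ , i≤) → s≤s z≤n , s≤s i≤) (positions-bounds r))

positions-≤ : ∀ v → All (_≤ length v) (positions v)
positions-≤ v = All.map proj₂ (positions-bounds v)

map-nth-positions : ∀ v → map (nth v) (positions v) ≡ v
map-nth-positions [] = refl
map-nth-positions (x ∷ r) = begin
  map (nth (x ∷ r)) (positions (x ∷ r))              ≡⟨ cong (map (nth (x ∷ r))) (positions-∷ x r) ⟩
  x ∷ map (nth (x ∷ r)) (map suc (positions r))      ≡⟨ cong (x ∷_) (sym (map-∘ (positions r))) ⟩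
  x ∷ map (λ i → nth (x ∷ r) (suc i)) (map suc U)    ≡⟨ cong (x ∷_) (sym (map-∘ U)) ⟩
  x ∷ map (λ j → nth r (suc j)) U                    ≡⟨ cong (x ∷_) (map-∘ U) ⟩
  x ∷ map (nth r) (positions r)                      ≡⟨ cong (x ∷_) (map-nth-positions r) ⟩
  x ∷ r                                              ∎
  where open ≡-Reasoning
        U = upTo (length r)

nth-∷ʳ-last : ∀ (xs : List ℕ) y → nth (xs ∷ʳ y) (suc (length xs)) ≡ y
nth-∷ʳ-last [] y = refl
nth-∷ʳ-last (x ∷ []) y = refl
nth-∷ʳ-last (x ∷ x' ∷ xs) y = nth-∷ʳ-last (x' ∷ xs) y

nth-∷ʳ-init : ∀ (xs : List ℕ) y i → i ≤ length xs → nth (xs ∷ʳ y) i ≡ nth xs i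
nth-∷ʳ-init [] y zero _ = refl
nth-∷ʳ-init (x ∷ xs) y zero _ = refl
nth-∷ʳ-init (x ∷ xs) y (suc zero) _ = refl
nth-∷ʳ-init (x ∷ x' ∷ xs) y (suc (suc i)) (s≤s i≤) = nth-∷ʳ-init (x' ∷ xs) y (suc i) i≤

nth-All≤ : ∀ {N} (L : List ℕ) k → All (_≤ N) L → nth L k ≤ N
nth-All≤ [] k _ = z≤n
nth-All≤ (x ∷ L) zero _ = z≤n
nth-All≤ (x ∷ L) (suc zero) (x≤ ∷ _) = x≤
nth-All≤ (x ∷ L) (suc (suc k)) (_ ∷ L≤) = nth-All≤ L (suc k) L≤

drop-nth : ∀ (v : List ℕ) k → suc k ≤ length v → drop k v ≡ nth v (suc k) ∷ drop (suc k) v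
drop-nth (x ∷ r) zero _ = refl
drop-nth (x ∷ r) (suc k) (s≤s k<) = drop-nth r k k<

maxw-insert : ∀ xs y ys → maxw (xs ++ y ∷ ys) ≡ y ⊔ maxw (xs ++ ys)
maxw-insert [] y ys = refl
maxw-insert (x ∷ xs) y ys = begin
  x ⊔ maxw (xs ++ y ∷ ys) ≡⟨ cong (x ⊔_) (maxw-insert xs y ys) ⟩
  x ⊔ (y ⊔ M)             ≡⟨ sym (⊔-assoc x y M) ⟩
  (x ⊔ y) ⊔ M             ≡⟨ cong (_⊔ M) (⊔-comm x y) ⟩
  (y ⊔ x) ⊔ M             ≡⟨ ⊔-assoc y x M ⟩
  y ⊔ (x ⊔ M)             ∎
  where open ≡-Reasoning
        M = maxw (xs ++ ys)

All≤maxw : ∀ v → All (_≤ maxw v) v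
All≤maxw [] = []
All≤maxw (x ∷ v) = m≤m⊔n x (maxw v) ∷ All.map (λ le → ≤-trans le (m≤n⊔m x (maxw v))) (All≤maxw v)

foldr-⊔-attained : ∀ {Q : ℕ → Set} L → 1 ≤ length L → All Q L → Q (foldr _⊔_ 0 L)
foldr-⊔-attained {Q} (x ∷ []) _ (q ∷ []) = subst Q (sym (⊔-identityʳ x)) q
foldr-⊔-attained {Q} (x ∷ y ∷ L) _ (q ∷ qs) with ⊔-sel x (foldr _⊔_ 0 (y ∷ L))
... | inj₁ e = subst Q (sym e) q
... | inj₂ e = subst Q (sym e) (foldr-⊔-attained (y ∷ L) (s≤s z≤n) qs)

length-filter-insert : ∀ {P : ℕ → Set} (P? : Decidable P) xs {y} ys → P y →
  length (filter P? (xs ++ y ∷ ys)) ≡ suc (length (filter P? (xs ++ ys)))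
length-filter-insert P? [] ys py = cong length (filter-accept P? py)
length-filter-insert P? (x ∷ xs) ys py with does (P? x)
... | true = cong suc (length-filter-insert P? xs ys py)
... | false = length-filter-insert P? xs ys py

countGE-insert : ∀ k xs {y} ys → k ≤ y → countGE k (xs ++ y ∷ ys) ≡ suc (countGE k (xs ++ ys))
countGE-insert k = length-filter-insert (k ≤?_)

countGE-above-maxw : ∀ v → countGE (suc (maxw v)) v ≡ 0
countGE-above-maxw v =
  cong length (filter-none (suc (maxw v) ≤?_)
    (All.map (λ x≤ x> → <-irrefl refl (≤-<-trans x> (s≤s x≤))) (All≤maxw v)))

positionsWhere : (ℕ → List ℕ → Bool) → List ℕ → List ℕ
positionsWhere D [] = []
positionsWhere D (x ∷ r) =
  if D x r then 1 ∷ map suc (positionsWhere D r) else map suc (positionsWhere D r)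

filter-map-suc : ∀ {P : ℕ → Set} (P? : Decidable P) xs →
  filter P? (map suc xs) ≡ map suc (filter (λ i → P? (suc i)) xs)
filter-map-suc P? [] = refl
filter-map-suc P? (x ∷ xs) with does (P? (suc x))
... | true = cong (suc x ∷_) (filter-map-suc P? xs)
... | false = filter-map-suc P? xs

filter-∷-does : ∀ {P : ℕ → Set} (P? : Decidable P) {y} ys {b} → does (P? y) ≡ b →
  filter P? (y ∷ ys) ≡ (if b then y ∷ filter P? ys else filter P? ys)
filter-∷-does P? {y} ys refl with does (P? y)
... | true = refl
... | false = refl

filter-positions : ∀ D v {P : ℕ → Set} (P? : Decidable P) →
  (∀ i → 1 ≤ i → i ≤ length v → does (P? i) ≡ D (nth v i) (drop i v)) →
  filter P? (positions v) ≡ positionsWhere D v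
filter-positions D [] P? _ = refl
filter-positions D (x ∷ r) P? agree = begin
  filter P? (positions (x ∷ r))              ≡⟨ cong (filter P?) (positions-∷ x r) ⟩
  filter P? (1 ∷ map suc (positions r))      ≡⟨ filter-∷-does P? _ (agree 1 (s≤s z≤n) (s≤s z≤n)) ⟩
  (if D x r then 1 ∷ rest else rest)         ≡⟨ cong (λ z → if D x r then 1 ∷ z else z) rest≡ ⟩
  positionsWhere D (x ∷ r)                   ∎
  where
  open ≡-Reasoning
  rest = filter P? (map suc (positions r))
  rest≡ : rest ≡ map suc (positionsWhere D r)
  rest≡ = trans (filter-map-suc P? (positions r))
    (cong (map suc) (filter-positions D r (λ i → P? (suc i))
      (λ { (suc i) _ i≤ → agree (suc (suc i)) (s≤s z≤n) (s≤s i≤) })))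

length-positionsWhere-letter : ∀ {P : ℕ → Set} (P? : Decidable P) v →
  length (positionsWhere (λ x _ → does (P? x)) v) ≡ length (filter P? v)
length-positionsWhere-letter P? [] = refl
length-positionsWhere-letter P? (x ∷ v) with does (P? x)
... | true = cong suc (trans (length-map suc (positionsWhere _ v)) (length-positionsWhere-letter P? v))
... | false = trans (length-map suc (positionsWhere _ v)) (length-positionsWhere-letter P? v)

length-positionsWhere-no : ∀ D x r → D x r ≡ false →
  length (positionsWhere D (x ∷ r)) ≡ length (positionsWhere D r)
length-positionsWhere-no D x r e with D x r
length-positionsWhere-no D x r refl | false = length-map suc (positionsWhere D r)

length-positionsWhere-yes : ∀ D x r → D x r ≡ true →
  length (positionsWhere D (x ∷ r)) ≡ suc (length (positionsWhere D r))
length-positionsWhere-yes D x r e with D x r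
length-positionsWhere-yes D x r refl | true = cong suc (length-map suc (positionsWhere D r))

lookup0-++ˡ : ∀ (xs ys : List ℕ) a → a < length xs → lookup0 (xs ++ ys) a ≡ lookup0 xs a
lookup0-++ˡ (x ∷ xs) ys zero _ = refl
lookup0-++ˡ (x ∷ xs) ys (suc a) (s≤s a<) = lookup0-++ˡ xs ys a a<

lookup0-++ʳ : ∀ (xs ys : List ℕ) j → lookup0 (xs ++ ys) (length xs + j) ≡ lookup0 ys j
lookup0-++ʳ [] ys j = refl
lookup0-++ʳ (x ∷ xs) ys j = lookup0-++ʳ xs ys j

lookup0-map : ∀ (f : ℕ → ℕ) xs a → a < length xs → lookup0 (map f xs) a ≡ f (lookup0 xs a)
lookup0-map f (x ∷ xs) zero _ = refl
lookup0-map f (x ∷ xs) (suc a) (s≤s a<) = lookup0-map f xs a a<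

lookup0-reverse-map-suc : ∀ F ys a → a < length F →
  lookup0 (reverse (map suc F) ++ ys) a ≡ suc (lookup0 (reverse F) a)
lookup0-reverse-map-suc F ys a a< = begin
  lookup0 (reverse (map suc F) ++ ys) a  ≡⟨ cong (λ z → lookup0 (z ++ ys) a) (sym (reverse-map suc F)) ⟩
  lookup0 (map suc (reverse F) ++ ys) a  ≡⟨ lookup0-++ˡ (map suc (reverse F)) ys a a<ˢ ⟩
  lookup0 (map suc (reverse F)) a        ≡⟨ lookup0-map suc (reverse F) a a<ʳ ⟩
  suc (lookup0 (reverse F) a)            ∎
  where open ≡-Reasoning
        a<ʳ = subst (a <_) (sym (length-reverse F)) a<
        a<ˢ = subst (a <_) (sym (length-map suc (reverse F))) a<ʳ

record Split (D : ℕ → List ℕ → Bool) (v : List ℕ) (a i : ℕ) : Set where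
  constructor split
  field
    prefix : List ℕ
    letter : ℕ
    suffix : List ℕ
    v≡ : v ≡ prefix ++ letter ∷ suffix
    passes : D letter suffix ≡ true
    i≡ : i ≡ suc (length prefix)
    rank : length (positionsWhere D suffix) ≡ a

split-∷ : ∀ {D v a i} y → Split D v a i → Split D (y ∷ v) a (suc i)
split-∷ y (split p x s v≡ passes i≡ rank) = split (y ∷ p) x s (cong (y ∷_) v≡) passes (cong suc i≡) rank

split-reverse-lookup : ∀ D v a → a < length (positionsWhere D v) →
  Split D v a (lookup0 (reverse (positionsWhere D v)) a)
split-reverse-lookup D (y ∷ r) a a< with D y r in passes
... | false = subst (Split D (y ∷ r) a) (sym i≡) (split-∷ y (split-reverse-lookup D r a a<F))
  where
  F = positionsWhere D r
  a<F = subst (a <_) (length-map suc F) a<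
  i≡ : lookup0 (reverse (map suc F)) a ≡ suc (lookup0 (reverse F) a)
  i≡ = trans (cong (λ z → lookup0 z a) (sym (++-identityʳ (reverse (map suc F)))))
             (lookup0-reverse-map-suc F [] a a<F)
... | true with m≤n⇒m<n∨m≡n (≤-pred (subst (a <_) (cong suc (length-map suc (positionsWhere D r))) a<))
...   | inj₁ a<F = subst (Split D (y ∷ r) a) (sym i≡) (split-∷ y (split-reverse-lookup D r a a<F))
  where
  F = positionsWhere D r
  i≡ : lookup0 (reverse (1 ∷ map suc F)) a ≡ suc (lookup0 (reverse F) a)
  i≡ = trans (cong (λ z → lookup0 z a) (unfold-reverse 1 (map suc F)))
             (lookup0-reverse-map-suc F [ 1 ] a a<F)
...   | inj₂ refl = split [] y r refl passes i≡ refl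
  where
  F = positionsWhere D r
  R = reverse (map suc F)
  i≡ : lookup0 (reverse (1 ∷ map suc F)) (length F) ≡ 1
  i≡ = begin
    lookup0 (reverse (1 ∷ map suc F)) (length F)
      ≡⟨ cong (λ z → lookup0 z (length F)) (unfold-reverse 1 (map suc F)) ⟩
    lookup0 (R ++ [ 1 ]) (length F)               ≡⟨ cong (lookup0 (R ++ [ 1 ])) (sym |R|+0≡) ⟩
    lookup0 (R ++ [ 1 ]) (length R + 0)           ≡⟨ lookup0-++ʳ R [ 1 ] 0 ⟩
    1                                             ∎
    where open ≡-Reasoning
          |R|+0≡ = trans (+-identityʳ _) (trans (length-reverse (map suc F)) (length-map suc F))

does-true : ∀ {A : Set} (a? : Dec A) → does a? ≡ true → A
does-true (yes a) _ = a

isMax : ℕ → ℕ → List ℕ → Bool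
isMax m x _ = does (x ≟ m)

isMaxa : ℕ → ℕ → List ℕ → Bool
isMaxa m x r = does (suc x ≟ m) ∧ does (all? (_<? m) r)

Maxb≡positionsWhere : ∀ v → Maxb v ≡ positionsWhere (isMax (maxw v)) v
Maxb≡positionsWhere v = filter-positions (isMax (maxw v)) v (λ i → nth v i ≟ maxw v) (λ _ _ _ → refl)

Maxa≡positionsWhere : ∀ v → Maxa v ≡ positionsWhere (isMaxa (maxw v)) v
Maxa≡positionsWhere v = filter-positions (isMaxa m) v _ agree
  where
  m = maxw v
  all?-map : ∀ (f : ℕ → ℕ) xs → does (all? (λ j → f j <? m) xs) ≡ does (all? (_<? m) (map f xs))
  all?-map f [] = refl
  all?-map f (x ∷ xs) = cong (does (f x <? m) ∧_) (all?-map f xs)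
  agree : ∀ i → 1 ≤ i → i ≤ length v →
    does (suc (nth v i) ≟ m) ∧ does (all? (λ j → nth v j <? m) (drop i (positions v)))
      ≡ isMaxa m (nth v i) (drop i v)
  agree i _ _ = cong (does (suc (nth v i) ≟ m) ∧_) (begin
    does (all? (λ j → nth v j <? m) (drop i (positions v)))
      ≡⟨ all?-map (nth v) (drop i (positions v)) ⟩
    does (all? (_<? m) (map (nth v) (drop i (positions v))))
      ≡⟨ cong (λ z → does (all? (_<? m) z)) (sym (drop-map i (positions v))) ⟩
    does (all? (_<? m) (drop i (map (nth v) (positions v))))
      ≡⟨ cong (λ z → does (all? (_<? m) (drop i z))) (map-nth-positions v) ⟩
    does (all? (_<? m) (drop i v))
      ∎)
    where open ≡-Reasoning

length-Maxb : ∀ {m} v → maxw v ≡ m → length (Maxb v) ≡ length (filter (_≟ m) v)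
length-Maxb v refl = trans (cong length (Maxb≡positionsWhere v)) (length-positionsWhere-letter (_≟ maxw v) v)

length-Maxa : ∀ {m} v → maxw v ≡ m → length (Maxa v) ≡ length (positionsWhere (isMaxa m) v)
length-Maxa v refl = cong length (Maxa≡positionsWhere v)

isMaxa-self : ∀ m s → isMaxa m m s ≡ false
isMaxa-self m s rewrite dec-false (suc m ≟ m) (λ e → <⇒≢ (n<1+n m) (sym e)) = refl

isMaxa-before-max : ∀ m x zs → Any (m ≤_) zs → isMaxa m x zs ≡ false
isMaxa-before-max m x zs big =
  trans (cong (does (suc x ≟ m) ∧_) (dec-false (all? (_<? m) zs) (all<⇒¬any≥ zs big))) (∧-zeroʳ _)
  where
  all<⇒¬any≥ : ∀ zs → Any (m ≤_) zs → ¬ All (_< m) zs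
  all<⇒¬any≥ (z ∷ zs) (here m≤z) (z<m ∷ _) = <-irrefl refl (≤-<-trans m≤z z<m)
  all<⇒¬any≥ (z ∷ zs) (there big) (_ ∷ zs<m) = all<⇒¬any≥ zs big zs<m

length-Maxa-++ : ∀ m xs ys → Any (m ≤_) ys →
  length (positionsWhere (isMaxa m) (xs ++ ys)) ≡ length (positionsWhere (isMaxa m) ys)
length-Maxa-++ m [] ys _ = refl
length-Maxa-++ m (x ∷ xs) ys big =
  trans (length-positionsWhere-no (isMaxa m) x (xs ++ ys) (isMaxa-before-max m x (xs ++ ys) (++⁺ʳ xs big)))
        (length-Maxa-++ m xs ys big)

length-Maxa-after-max : ∀ m xs s →
  length (positionsWhere (isMaxa m) (xs ++ m ∷ s)) ≡ length (positionsWhere (isMaxa m) s)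
length-Maxa-after-max m xs s =
  trans (length-Maxa-++ m xs (m ∷ s) (here ≤-refl)) (length-positionsWhere-no (isMaxa m) m s (isMaxa-self m s))

isMaxa-below : ∀ m x s → All (_≤ m) s → isMaxa (suc m) x s ≡ does (x ≟ m)
isMaxa-below m x s s≤m =
  trans (cong (does (x ≟ m) ∧_) (dec-true (all? (_<? suc m) s) (All.map s≤s s≤m))) (∧-identityʳ _)

length-Maxa-below : ∀ m s → All (_≤ m) s →
  length (positionsWhere (isMaxa (suc m)) s) ≡ length (filter (_≟ m) s)
length-Maxa-below m [] _ = refl
length-Maxa-below m (x ∷ s) (_ ∷ s≤m) = by-cases (x ≟ m)
  where
  ih = length-Maxa-below m s s≤m
  by-cases : Dec (x ≡ m) →
    length (positionsWhere (isMaxa (suc m)) (x ∷ s)) ≡ length (filter (_≟ m) (x ∷ s))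
  by-cases (yes x≡m) = begin
    length (positionsWhere (isMaxa (suc m)) (x ∷ s))
      ≡⟨ length-positionsWhere-yes _ x s (trans (isMaxa-below m x s s≤m) (dec-true (x ≟ m) x≡m)) ⟩
    suc (length (positionsWhere (isMaxa (suc m)) s))  ≡⟨ cong suc ih ⟩
    suc (length (filter (_≟ m) s))                    ≡⟨ cong length (sym (filter-accept (_≟ m) x≡m)) ⟩
    length (filter (_≟ m) (x ∷ s))                    ∎
    where open ≡-Reasoning
  by-cases (no x≢m) = begin
    length (positionsWhere (isMaxa (suc m)) (x ∷ s))
      ≡⟨ length-positionsWhere-no _ x s (trans (isMaxa-below m x s s≤m) (dec-false (x ≟ m) x≢m)) ⟩
    length (positionsWhere (isMaxa (suc m)) s)  ≡⟨ ih ⟩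
    length (filter (_≟ m) s)                    ≡⟨ cong length (sym (filter-reject (_≟ m) x≢m)) ⟩
    length (filter (_≟ m) (x ∷ s))              ∎
    where open ≡-Reasoning

-- Inserting a letter into a word

record InsertionEffect (v v' : List ℕ) (m' nb na : ℕ) : Set where
  field
    maxw≡ : maxw v' ≡ m'
    length-Maxb≡ : length (Maxb v') ≡ nb
    length-Maxa≡ : length (Maxa v') ≡ na
    countGE-suc : ∀ k → k ≤ m' → countGE k v' ≡ suc (countGE k v)

InsertionEffect-cong : ∀ {v v₁ v₂ m nb₁ nb₂ na₁ na₂} → v₁ ≡ v₂ → nb₁ ≡ nb₂ → na₁ ≡ na₂ →
  InsertionEffect v v₁ m nb₁ na₁ → InsertionEffect v v₂ m nb₂ na₂
InsertionEffect-cong refl refl refl E = E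

insert-new-max : ∀ {v v'} xs s → v ≡ xs ++ s → v' ≡ xs ++ suc (maxw v) ∷ s →
  InsertionEffect v v' (suc (maxw v)) 1 (length (filter (_≟ maxw v) s))
insert-new-max xs s refl refl = record
  { maxw≡ = maxw≡
  ; length-Maxb≡ = length-Maxb≡
  ; length-Maxa≡ = length-Maxa≡
  ; countGE-suc = λ k k≤ → countGE-insert k xs s k≤
  }
  where
  open ≡-Reasoning
  m = maxw (xs ++ s)
  v' = xs ++ suc m ∷ s
  ≤m : All (_≤ m) (xs ++ s)
  ≤m = All≤maxw (xs ++ s)
  maxw≡ : maxw v' ≡ suc m
  maxw≡ = trans (maxw-insert xs (suc m) s) (m≥n⇒m⊔n≡m (n≤1+n m))
  length-Maxb≡ : length (Maxb v') ≡ 1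
  length-Maxb≡ = begin
    length (Maxb v')                        ≡⟨ length-Maxb v' maxw≡ ⟩
    length (filter (_≟ suc m) v')           ≡⟨ length-filter-insert (_≟ suc m) xs s refl ⟩
    suc (length (filter (_≟ suc m) (xs ++ s)))
      ≡⟨ cong (suc ∘ length) (filter-none (_≟ suc m) (All.map (λ x≤ e → <⇒≢ (s≤s x≤) e) ≤m)) ⟩
    1                                       ∎
  length-Maxa≡ : length (Maxa v') ≡ length (filter (_≟ m) s)
  length-Maxa≡ = begin
    length (Maxa v')                                   ≡⟨ length-Maxa v' maxw≡ ⟩
    length (positionsWhere (isMaxa (suc m)) v')        ≡⟨ length-Maxa-after-max (suc m) xs s ⟩
    length (positionsWhere (isMaxa (suc m)) s)         ≡⟨ length-Maxa-below m s (++⁻ʳ xs ≤m) ⟩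
    length (filter (_≟ m) s)                           ∎

insert-max-copy : ∀ {v v'} xs s → v ≡ xs ++ s → v' ≡ xs ++ maxw v ∷ s →
  InsertionEffect v v' (maxw v) (suc (length (Maxb v))) (length (positionsWhere (isMaxa (maxw v)) s))
insert-max-copy xs s refl refl = record
  { maxw≡ = maxw≡
  ; length-Maxb≡ = length-Maxb≡
  ; length-Maxa≡ = trans (length-Maxa v' maxw≡) (length-Maxa-after-max m xs s)
  ; countGE-suc = λ k k≤ → countGE-insert k xs s k≤
  }
  where
  open ≡-Reasoning
  m = maxw (xs ++ s)
  v' = xs ++ m ∷ s
  maxw≡ : maxw v' ≡ m
  maxw≡ = trans (maxw-insert xs m s) (⊔-idem m)
  length-Maxb≡ : length (Maxb v') ≡ suc (length (Maxb (xs ++ s)))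
  length-Maxb≡ = begin
    length (Maxb v')                         ≡⟨ length-Maxb v' maxw≡ ⟩
    length (filter (_≟ m) v')                ≡⟨ length-filter-insert (_≟ m) xs s refl ⟩
    suc (length (filter (_≟ m) (xs ++ s)))   ≡⟨ cong suc (sym (length-Maxb (xs ++ s) refl)) ⟩
    suc (length (Maxb (xs ++ s)))            ∎

take-suc-length-++ : ∀ p (x : ℕ) s → take (suc (length p)) (p ++ x ∷ s) ≡ p ++ [ x ]
take-suc-length-++ [] x s = refl
take-suc-length-++ (y ∷ p) x s = cong (y ∷_) (take-suc-length-++ p x s)

drop-suc-length-++ : ∀ p (x : ℕ) s → drop (suc (length p)) (p ++ x ∷ s) ≡ s
drop-suc-length-++ [] x s = refl
drop-suc-length-++ (y ∷ p) x s = drop-suc-length-++ p x s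

nth-suc-length-++ : ∀ p (x : ℕ) s → nth (p ++ x ∷ s) (suc (length p)) ≡ x
nth-suc-length-++ [] x s = refl
nth-suc-length-++ (y ∷ []) x s = refl
nth-suc-length-++ (y ∷ y' ∷ p) x s = nth-suc-length-++ (y' ∷ p) x s

ins-after : ∀ p (x : ℕ) s → ins (suc (length p)) (p ++ x ∷ s) ≡ (p ++ [ x ]) ++ suc x ∷ s
ins-after p x s
  rewrite take-suc-length-++ p x s | drop-suc-length-++ p x s | nth-suc-length-++ p x s = refl

insert-after-Maxb : ∀ v a → a < length (Maxb v) →
  InsertionEffect v (ins (lookup0 (reverse (Maxb v)) a) v) (suc (maxw v)) 1 a
insert-after-Maxb v a a<
  with split p x s v≡ x-max i≡ rank ←
         split-reverse-lookup (isMax (maxw v)) v a (subst (λ L → a < length L) (Maxb≡positionsWhere v) a<)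
  = InsertionEffect-cong (sym ins≡) refl (trans (sym (length-positionsWhere-letter (_≟ m) s)) rank)
      (insert-new-max (p ++ [ m ]) s (trans v≡ (trans (cong (λ z → p ++ z ∷ s) x≡m) (sym (∷ʳ-++ p m s))))
        refl)
  where
  m = maxw v
  x≡m : x ≡ m
  x≡m = does-true (x ≟ m) x-max
  ins≡ : ins (lookup0 (reverse (Maxb v)) a) v ≡ (p ++ [ m ]) ++ suc m ∷ s
  ins≡ = begin
    ins (lookup0 (reverse (Maxb v)) a) v
      ≡⟨ cong₂ ins (trans (cong (λ L → lookup0 (reverse L) a) (Maxb≡positionsWhere v)) i≡) v≡ ⟩
    ins (suc (length p)) (p ++ x ∷ s)     ≡⟨ ins-after p x s ⟩
    (p ++ [ x ]) ++ suc x ∷ s             ≡⟨ cong (λ z → (p ++ [ z ]) ++ suc z ∷ s) x≡m ⟩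
    (p ++ [ m ]) ++ suc m ∷ s             ∎
    where open ≡-Reasoning

insert-after-Maxa : ∀ v j → j < length (Maxa v) →
  InsertionEffect v (ins (lookup0 (reverse (Maxa v)) j) v) (maxw v) (suc (length (Maxb v))) j
insert-after-Maxa v j j<
  with split p x s v≡ x-maxa i≡ rank ←
         split-reverse-lookup (isMaxa (maxw v)) v j (subst (λ L → j < length L) (Maxa≡positionsWhere v) j<)
  = InsertionEffect-cong (sym ins≡) refl rank
      (insert-max-copy (p ++ [ x ]) s (trans v≡ (sym (∷ʳ-++ p x s))) refl)
  where
  m = maxw v
  x+1≡m : suc x ≡ m
  x+1≡m = does-true (suc x ≟ m) (∧-true-left x-maxa)
    where
    ∧-true-left : ∀ {b c} → b ∧ c ≡ true → b ≡ true
    ∧-true-left {true} _ = refl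
  ins≡ : ins (lookup0 (reverse (Maxa v)) j) v ≡ (p ++ [ x ]) ++ m ∷ s
  ins≡ = begin
    ins (lookup0 (reverse (Maxa v)) j) v
      ≡⟨ cong₂ ins (trans (cong (λ L → lookup0 (reverse L) j) (Maxa≡positionsWhere v)) i≡) v≡ ⟩
    ins (suc (length p)) (p ++ x ∷ s)     ≡⟨ ins-after p x s ⟩
    (p ++ [ x ]) ++ suc x ∷ s             ≡⟨ cong (λ z → (p ++ [ x ]) ++ z ∷ s) x+1≡m ⟩
    (p ++ [ x ]) ++ m ∷ s                 ∎
    where open ≡-Reasoning

data BlockStart (v : List ℕ) : ℕ → Set where
  initial : nth v 1 ≡ maxw v → BlockStart v 1
  after : ∀ {k} → suc (suc k) ≤ length v → nth v (suc (suc k)) ≡ maxw v → nth v (suc k) ≢ maxw v →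
    BlockStart v (suc (suc k))

blockStart-BlockStart : ∀ v p → suc p ≤ length v → nth v (suc p) ≡ maxw v →
  BlockStart v (blockStart v (suc p))
blockStart-BlockStart v zero _ e = initial e
blockStart-BlockStart v (suc p) p+2≤ e with nth v (suc p) ≡ᵇ maxw v in d
... | true = blockStart-BlockStart v p (≤-trans (n≤1+n _) p+2≤) (≡ᵇ⇒≡ _ _ (subst T (sym d) tt))
... | false = after p+2≤ e (λ eq → subst T d (≡⇒≡ᵇ _ _ eq))

i0-BlockStart : ∀ v → 1 ≤ length (Maxb v) → BlockStart v (i0 v)
i0-BlockStart v nonempty = at-maximal-position (foldr _⊔_ 0 (Maxb v))
  (foldr-⊔-attained (Maxb v) nonempty
    (All.zip (filter⁺ P? (positions-bounds v) , all-filter P? (positions v))))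
  where
  P? = λ i → nth v i ≟ maxw v
  at-maximal-position : ∀ q → (1 ≤ q × q ≤ length v) × nth v q ≡ maxw v → BlockStart v (blockStart v q)
  at-maximal-position (suc p) ((_ , q≤) , e) = blockStart-BlockStart v p q≤ e

insert-before-last-block : ∀ v → IsAreaSeq v → 1 ≤ length (Maxb v) →
  InsertionEffect v (ins (i0 v ∸ 1) v) (maxw v) (suc (length (Maxb v))) (length (Maxa v))
insert-before-last-block [] _ ()
insert-before-last-block v@(x ∷ r) (refl , st) nonempty = from-block-start (i0-BlockStart v nonempty)
  where
  m = maxw v
  from-block-start : ∀ {t} → BlockStart v t →
    InsertionEffect v (ins (t ∸ 1) v) m (suc (length (Maxb v))) (length (Maxa v))
  from-block-start (initial e) =
    InsertionEffect-cong refl refl (sym (length-Maxa v refl)) (insert-max-copy [] v refl (cong (_∷ v) e))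
  from-block-start (after {k} k+2≤ e ne) =
    InsertionEffect-cong (cong (λ z → take (suc k) v ++ z ∷ drop (suc k) v) (sym x+1≡m)) refl Maxa≡
      (insert-max-copy (take (suc k) v) (drop (suc k) v) (sym (take++drop≡id (suc k) v)) refl)
    where
    -- The letter before a block of maximal letters is m - 1, since it is < m and steps rise by at most 1.
    x+1≡m : suc (nth v (suc k)) ≡ m
    x+1≡m = ≤-antisym (≤∧≢⇒< (nth-All≤ v (suc k) (All≤maxw v)) ne)
                      (subst (_≤ suc (nth v (suc k))) e (Steps-nth v st k))
    max-ahead : Any (m ≤_) (drop (suc k) v)
    max-ahead = subst (Any (m ≤_)) (sym (drop-nth v (suc k) k+2≤)) (here (≤-reflexive (sym e)))
    Maxa≡ : length (positionsWhere (isMaxa m) (drop (suc k) v)) ≡ length (Maxa v)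
    Maxa≡ = begin
      length (positionsWhere (isMaxa m) (drop (suc k) v))
        ≡⟨ sym (length-Maxa-++ m (take (suc k) v) (drop (suc k) v) max-ahead) ⟩
      length (positionsWhere (isMaxa m) (take (suc k) v ++ drop (suc k) v))
        ≡⟨ cong (λ z → length (positionsWhere (isMaxa m) z)) (take++drop≡id (suc k) v) ⟩
      length (positionsWhere (isMaxa m) v)  ≡⟨ sym (length-Maxa v refl) ⟩
      length (Maxa v)                       ∎
      where open ≡-Reasoning

-- One step of ψ

lookup0-admissible-Maxb : ∀ x r a → a < length (Maxb (x ∷ r)) →
  lookup0 (admissible (x ∷ r)) a ≡ lookup0 (reverse (Maxb (x ∷ r))) a
lookup0-admissible-Maxb x r a a< =
  lookup0-++ˡ (reverse (Maxb (x ∷ r))) (reverse (Maxa (x ∷ r)) ++ [ i0 (x ∷ r) ∸ 1 ]) a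
    (subst (a <_) (sym (length-reverse (Maxb (x ∷ r)))) a<)

lookup0-admissible-Maxa : ∀ x r j → j < length (Maxa (x ∷ r)) →
  lookup0 (admissible (x ∷ r)) (length (Maxb (x ∷ r)) + j) ≡ lookup0 (reverse (Maxa (x ∷ r))) j
lookup0-admissible-Maxa x r j j< = begin
  lookup0 (Rb ++ Ra ++ I) (length (Maxb v) + j)
    ≡⟨ cong (λ n → lookup0 (Rb ++ Ra ++ I) (n + j)) (sym (length-reverse (Maxb v))) ⟩
  lookup0 (Rb ++ Ra ++ I) (length Rb + j)
    ≡⟨ lookup0-++ʳ Rb (Ra ++ I) j ⟩
  lookup0 (Ra ++ I) j
    ≡⟨ lookup0-++ˡ Ra I j (subst (j <_) (sym (length-reverse (Maxa v))) j<) ⟩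
  lookup0 Ra j
    ∎
  where open ≡-Reasoning
        v = x ∷ r
        Rb = reverse (Maxb v)
        Ra = reverse (Maxa v)
        I = [ i0 v ∸ 1 ]

lookup0-admissible-i0 : ∀ x r →
  lookup0 (admissible (x ∷ r)) (length (Maxb (x ∷ r)) + length (Maxa (x ∷ r))) ≡ i0 (x ∷ r) ∸ 1
lookup0-admissible-i0 x r = begin
  lookup0 (Rb ++ Ra ++ [ i ]) (length (Maxb v) + length (Maxa v))
    ≡⟨ cong₂ (λ n n' → lookup0 (Rb ++ Ra ++ [ i ]) (n + n'))
             (sym (length-reverse (Maxb v))) (sym (trans (+-identityʳ _) (length-reverse (Maxa v)))) ⟩
  lookup0 (Rb ++ Ra ++ [ i ]) (length Rb + (length Ra + 0))  ≡⟨ lookup0-++ʳ Rb (Ra ++ [ i ]) (length Ra + 0) ⟩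
  lookup0 (Ra ++ [ i ]) (length Ra + 0)                      ≡⟨ lookup0-++ʳ Ra [ i ] 0 ⟩
  i                                                          ∎
  where open ≡-Reasoning
        v = x ∷ r
        Rb = reverse (Maxb v)
        Ra = reverse (Maxa v)
        i = i0 v ∸ 1

admissible-insert-low : ∀ v {β a} → length (Maxb v) ≡ suc β → a ≤ β →
  InsertionEffect v (ins (lookup0 (admissible v) a) v) (suc (maxw v)) 1 a
admissible-insert-low [] () _
admissible-insert-low v@(x ∷ r) {a = a} Maxb≡ a≤β =
  InsertionEffect-cong (cong (λ i → ins i v) (sym (lookup0-admissible-Maxb x r a a<))) refl refl
    (insert-after-Maxb v a a<)
  where a< = subst (a <_) (sym Maxb≡) (s≤s a≤β)

admissible-insert-high : ∀ v {β a' a} → IsAreaSeq v → length (Maxb v) ≡ suc β → length (Maxa v) ≡ a' ∸ β →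
  β < a → a ≤ suc a' →
  InsertionEffect v (ins (lookup0 (admissible v) a) v) (maxw v) (suc (suc β)) (a ∸ suc β)
admissible-insert-high [] _ ()
admissible-insert-high v@(x ∷ r) {β} {a'} {a} area Maxb≡ Maxa≡ β<a a≤
  with m≤n⇒m<n∨m≡n (subst (a ∸ suc β ≤_) (sym Maxa≡) (∸-monoˡ-≤ (suc β) a≤))
... | inj₁ j< =
  InsertionEffect-cong (cong (λ i → ins i v)
      (sym (trans (cong (lookup0 (admissible v)) a≡) (lookup0-admissible-Maxa x r j j<))))
    (cong suc Maxb≡) refl (insert-after-Maxa v j j<)
  where
  j = a ∸ suc β
  a≡ : a ≡ length (Maxb v) + j
  a≡ = trans (sym (m+[n∸m]≡n β<a)) (cong (_+ j) (sym Maxb≡))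
... | inj₂ j≡ =
  InsertionEffect-cong (cong (λ i → ins i v)
      (sym (trans (cong (lookup0 (admissible v)) a≡) (lookup0-admissible-i0 x r))))
    (cong suc Maxb≡) (sym j≡) (insert-before-last-block v area (subst (1 ≤_) (sym Maxb≡) (s≤s z≤n)))
  where
  j = a ∸ suc β
  a≡ : a ≡ length (Maxb v) + length (Maxa v)
  a≡ = trans (sym (m+[n∸m]≡n β<a)) (cong₂ _+_ (sym Maxb≡) j≡)

ψ-∷ʳ : ∀ w a → ψ (w ∷ʳ a) ≡ ins (lookup0 (admissible (ψ w)) a) (ψ w)
ψ-∷ʳ w a = cong ψrev (reverse-++ w [ a ])

ψ-∷ʳ-IsAreaSeq : ∀ w a → IsAreaSeq (ψ w) → 1 ≤ length (Maxb (ψ w)) → IsAreaSeq (ψ (w ∷ʳ a))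
ψ-∷ʳ-IsAreaSeq w a area nonempty with ψ w | ψ-∷ʳ w a
ψ-∷ʳ-IsAreaSeq w a area () | [] | _
ψ-∷ʳ-IsAreaSeq w a area _ | x ∷ r | ψ≡ =
  subst IsAreaSeq (sym ψ≡) (ins-IsAreaSeq (lookup0 (admissible (x ∷ r)) a) x r area)

-- Bounces

bounceStep : ℕ → ℕ → ℕ
bounceStep p x with suc p ≤? x
... | yes _ = suc p
... | no _ = 0

bounceStep-≤ : ∀ p x → x ≤ p → bounceStep p x ≡ 0
bounceStep-≤ p x x≤p with suc p ≤? x
... | yes p<x = ⊥-elim (<-irrefl refl (≤-trans p<x x≤p))
... | no _ = refl

bounceStep-> : ∀ p x → p < x → bounceStep p x ≡ suc p
bounceStep-> p x p<x with suc p ≤? x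
... | yes _ = refl
... | no p≮x = ⊥-elim (p≮x p<x)

bounceGo-∷ : ∀ p x xs → bounceGo p (x ∷ xs) ≡ bounceStep p x ∷ bounceGo (bounceStep p x) xs
bounceGo-∷ p x xs with suc p ≤? x
... | yes _ = refl
... | no _ = refl

lastBounceFrom : ℕ → List ℕ → ℕ
lastBounceFrom p [] = p
lastBounceFrom p (x ∷ xs) = lastBounceFrom (bounceStep p x) xs

lastBounce : List ℕ → ℕ
lastBounce [] = 0
lastBounce (x ∷ r) = lastBounceFrom 0 r

bounceGo-∷ʳ : ∀ p xs a → bounceGo p (xs ∷ʳ a) ≡ bounceGo p xs ∷ʳ bounceStep (lastBounceFrom p xs) a
bounceGo-∷ʳ p [] a = bounceGo-∷ p a []
bounceGo-∷ʳ p (x ∷ xs) a rewrite bounceGo-∷ p x (xs ∷ʳ a) | bounceGo-∷ p x xs =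
  cong (bounceStep p x ∷_) (bounceGo-∷ʳ (bounceStep p x) xs a)

lastBounceFrom-∷ʳ : ∀ p xs a → lastBounceFrom p (xs ∷ʳ a) ≡ bounceStep (lastBounceFrom p xs) a
lastBounceFrom-∷ʳ p [] a = refl
lastBounceFrom-∷ʳ p (x ∷ xs) a = lastBounceFrom-∷ʳ (bounceStep p x) xs a

lastBounce-∷ʳ : ∀ x r a → lastBounce ((x ∷ r) ∷ʳ a) ≡ bounceStep (lastBounce (x ∷ r)) a
lastBounce-∷ʳ x r = lastBounceFrom-∷ʳ 0 r

bounce-∷ʳ : ∀ w a → bounce (w ∷ʳ a) ≡ bounce w ∷ʳ lastBounce (w ∷ʳ a)
bounce-∷ʳ [] a = refl
bounce-∷ʳ (x ∷ r) a =
  cong (0 ∷_) (trans (bounceGo-∷ʳ 0 r a) (cong (bounceGo 0 r ∷ʳ_) (sym (lastBounce-∷ʳ x r a))))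

length-bounce : ∀ w → length (bounce w) ≡ length w
length-bounce [] = refl
length-bounce (x ∷ r) = cong suc (length-bounceGo 0 r)
  where
  length-bounceGo : ∀ p xs → length (bounceGo p xs) ≡ length xs
  length-bounceGo p [] = refl
  length-bounceGo p (x ∷ xs) rewrite bounceGo-∷ p x xs = cong suc (length-bounceGo _ xs)

nth-bounce-length : ∀ w → nth (bounce w) (length w) ≡ lastBounce w
nth-bounce-length [] = refl
nth-bounce-length (x ∷ r) = nth-bounceGo 0 r
  where
  nth-bounceGo : ∀ p r → nth (p ∷ bounceGo p r) (suc (length r)) ≡ lastBounceFrom p r
  nth-bounceGo p [] = refl
  nth-bounceGo p (x ∷ r) rewrite bounceGo-∷ p x r = nth-bounceGo (bounceStep p x) r

isBounce? : (bs : List ℕ) → Decidable (λ i → (2 ≤ i) × (nth bs i ≡ 0))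
isBounce? bs i = (2 ≤? i) ×-dec (nth bs i ≟ 0)

bounces-≤ : ∀ w → All (_≤ length w) (bounces w)
bounces-≤ w = filter⁺ (isBounce? (bounce w)) (positions-≤ w)

filter-cong-All : ∀ {P Q : ℕ → Set} (P? : Decidable P) (Q? : Decidable Q) xs →
  All (λ i → does (P? i) ≡ does (Q? i)) xs → filter P? xs ≡ filter Q? xs
filter-cong-All P? Q? [] [] = refl
filter-cong-All P? Q? (x ∷ xs) (e ∷ es) with does (P? x) | does (Q? x)
... | true | true = cong (x ∷_) (filter-cong-All P? Q? xs es)
... | false | false = filter-cong-All P? Q? xs es
filter-cong-All P? Q? (x ∷ xs) (() ∷ es) | true | false
filter-cong-All P? Q? (x ∷ xs) (() ∷ es) | false | true

bounces-∷ʳ : ∀ w a →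
  bounces (w ∷ʳ a) ≡ bounces w ++ filter (isBounce? (bounce (w ∷ʳ a))) [ suc (length w) ]
bounces-∷ʳ w a = begin
  filter (isBounce? B') (positions (w ∷ʳ a))
    ≡⟨ cong (filter (isBounce? B')) (positions-∷ʳ w a) ⟩
  filter (isBounce? B') (positions w ∷ʳ suc (length w))
    ≡⟨ filter-++ (isBounce? B') (positions w) [ suc (length w) ] ⟩
  filter (isBounce? B') (positions w) ++ filter (isBounce? B') [ suc (length w) ]
    ≡⟨ cong (_++ filter (isBounce? B') [ suc (length w) ]) (filter-cong-All _ _ (positions w) agree) ⟩
  bounces w ++ filter (isBounce? B') [ suc (length w) ]
    ∎
  where
  open ≡-Reasoning
  B' = bounce (w ∷ʳ a)
  agree : All (λ i → does (isBounce? B' i) ≡ does (isBounce? (bounce w) i)) (positions w)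
  agree = All.map (λ {i} i≤ → cong (λ b → does (2 ≤? i) ∧ does (b ≟ 0)) (begin
      nth B' i                              ≡⟨ cong (λ bs → nth bs i) (bounce-∷ʳ w a) ⟩
      nth (bounce w ∷ʳ lastBounce (w ∷ʳ a)) i
        ≡⟨ nth-∷ʳ-init (bounce w) _ i (subst (i ≤_) (sym (length-bounce w)) i≤) ⟩
      nth (bounce w) i                      ∎))
    (positions-≤ w)

nth-bounce-∷ʳ-last : ∀ w a → nth (bounce (w ∷ʳ a)) (suc (length w)) ≡ lastBounce (w ∷ʳ a)
nth-bounce-∷ʳ-last w a = begin
  nth (bounce (w ∷ʳ a)) (suc (length w))
    ≡⟨ cong (λ bs → nth bs (suc (length w))) (bounce-∷ʳ w a) ⟩
  nth (bounce w ∷ʳ b) (suc (length w))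
    ≡⟨ cong (λ n → nth (bounce w ∷ʳ b) (suc n)) (sym (length-bounce w)) ⟩
  nth (bounce w ∷ʳ b) (suc (length (bounce w)))
    ≡⟨ nth-∷ʳ-last (bounce w) b ⟩
  b
    ∎
  where open ≡-Reasoning
        b = lastBounce (w ∷ʳ a)

bounces-∷ʳ-restart : ∀ w a → 1 ≤ length w → lastBounce (w ∷ʳ a) ≡ 0 →
  bounces (w ∷ʳ a) ≡ bounces w ∷ʳ suc (length w)
bounces-∷ʳ-restart [] a () _
bounces-∷ʳ-restart w@(_ ∷ _) a _ b≡0 = trans (bounces-∷ʳ w a) (cong (bounces w ++_)
  (filter-accept (isBounce? (bounce (w ∷ʳ a))) {xs = []}
    (s≤s (s≤s z≤n) , trans (nth-bounce-∷ʳ-last w a) b≡0)))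

bounces-∷ʳ-climb : ∀ w a → lastBounce (w ∷ʳ a) ≢ 0 → bounces (w ∷ʳ a) ≡ bounces w
bounces-∷ʳ-climb w a b≢0 = trans (bounces-∷ʳ w a) (trans (cong (bounces w ++_)
  (filter-reject (isBounce? (bounce (w ∷ʳ a))) {xs = []}
    (λ (_ , b≡0) → b≢0 (trans (sym (nth-bounce-∷ʳ-last w a)) b≡0))))
  (++-identityʳ (bounces w)))

lastBounce-∷ʳ≡0⇔ : ∀ w a → 1 ≤ length w →
  (lastBounce (w ∷ʳ a) ≡ 0) ⇔ (length (bounces (w ∷ʳ a)) ≡ length (bounces w) + 1)
lastBounce-∷ʳ≡0⇔ w a 1≤w = mk⇔
  (λ b≡0 → trans (cong length (bounces-∷ʳ-restart w a 1≤w b≡0)) (length-++ (bounces w)))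
  from
  where
  from : length (bounces (w ∷ʳ a)) ≡ length (bounces w) + 1 → lastBounce (w ∷ʳ a) ≡ 0
  from len≡ with lastBounce (w ∷ʳ a) ≟ 0
  ... | yes b≡0 = b≡0
  ... | no b≢0 = ⊥-elim (<-irrefl (trans (cong length (sym (bounces-∷ʳ-climb w a b≢0))) len≡)
                                  (subst (length (bounces w) <_) (+-comm 1 _) ≤-refl))

-- The invariant

-- a is the last letter of w.
record Invariant (w : List ℕ) (a : ℕ) : Set where
  field
    area : IsAreaSeq (ψ w)
    maxw≡ : maxw (ψ w) ≡ length (bounces w)
    length-Maxb≡ : length (Maxb (ψ w)) ≡ suc (lastBounce w)
    length-Maxa≡ : length (Maxa (ψ w)) ≡ a ∸ lastBounce w
    countGE≡ : ∀ k → 1 ≤ k → k ≤ maxw (ψ w) → countGE k (ψ w) ≡ suc (length w) ∸ nth (bounces w) k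

Invariant-[0] : Invariant (0 ∷ []) 0
Invariant-[0] = record
  { area = refl , tt ; maxw≡ = refl ; length-Maxb≡ = refl ; length-Maxa≡ = refl
  ; countGE≡ = λ { k (s≤s _) () } }

countGE-old-levels : ∀ {w a' v' m' nb na} → Invariant w a' → InsertionEffect (ψ w) v' m' nb na →
  maxw (ψ w) ≤ m' → ∀ k → 1 ≤ k → k ≤ maxw (ψ w) →
  countGE k v' ≡ suc (suc (length w)) ∸ nth (bounces w) k
countGE-old-levels {w} {v' = v'} I E m≤m' k 1≤k k≤m = begin
  countGE k v'                         ≡⟨ InsertionEffect.countGE-suc E k (≤-trans k≤m m≤m') ⟩
  suc (countGE k (ψ w))                ≡⟨ cong suc (Invariant.countGE≡ I k 1≤k k≤m) ⟩
  suc (suc (length w) ∸ b)             ≡⟨ sym (+-∸-assoc 1 (≤-trans b≤n (n≤1+n _))) ⟩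
  suc (suc (length w)) ∸ b             ∎
  where open ≡-Reasoning
        b = nth (bounces w) k
        b≤n = nth-All≤ (bounces w) k (bounces-≤ w)

Invariant-∷ʳ-restart : ∀ x r {a'} a → Invariant (x ∷ r) a' → a ≤ lastBounce (x ∷ r) →
  Invariant ((x ∷ r) ∷ʳ a) a
Invariant-∷ʳ-restart x r a I a≤β = record
  { area = ψ-∷ʳ-IsAreaSeq w a I.area (subst (1 ≤_) (sym I.length-Maxb≡) (s≤s z≤n))
  ; maxw≡ = trans E.maxw≡ (trans (cong suc I.maxw≡)
              (sym (trans (cong length bounces≡) (length-∷ʳ (bounces w) _))))
  ; length-Maxb≡ = trans E.length-Maxb≡ (cong suc (sym last≡0))
  ; length-Maxa≡ = trans E.length-Maxa≡ (cong (a ∸_) (sym last≡0))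
  ; countGE≡ = countGE≡
  }
  where
  w = x ∷ r
  module I = Invariant I
  m = maxw (ψ w)
  E : InsertionEffect (ψ w) (ψ (w ∷ʳ a)) (suc m) 1 a
  E = InsertionEffect-cong (sym (ψ-∷ʳ w a)) refl refl (admissible-insert-low (ψ w) I.length-Maxb≡ a≤β)
  module E = InsertionEffect E
  last≡0 : lastBounce (w ∷ʳ a) ≡ 0
  last≡0 = trans (lastBounce-∷ʳ x r a) (bounceStep-≤ _ a a≤β)
  bounces≡ : bounces (w ∷ʳ a) ≡ bounces w ∷ʳ suc (length w)
  bounces≡ = bounces-∷ʳ-restart w a (s≤s z≤n) last≡0
  countGE≡ : ∀ k → 1 ≤ k → k ≤ maxw (ψ (w ∷ʳ a)) →
    countGE k (ψ (w ∷ʳ a)) ≡ suc (length (w ∷ʳ a)) ∸ nth (bounces (w ∷ʳ a)) k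
  countGE≡ k 1≤k k≤ rewrite bounces≡ | length-∷ʳ w a
    with m≤n⇒m<n∨m≡n (subst (k ≤_) E.maxw≡ k≤)
  ... | inj₁ (s≤s k≤m) = trans (countGE-old-levels I E (n≤1+n m) k 1≤k k≤m)
    (cong (suc (suc (length w)) ∸_) (sym (nth-∷ʳ-init (bounces w) _ k (subst (k ≤_) I.maxw≡ k≤m))))
  ... | inj₂ refl = begin
    countGE (suc m) (ψ (w ∷ʳ a))           ≡⟨ E.countGE-suc (suc m) ≤-refl ⟩
    suc (countGE (suc m) (ψ w))            ≡⟨ cong suc (countGE-above-maxw (ψ w)) ⟩
    1                                      ≡⟨ sym (m+n∸n≡m 1 (suc n)) ⟩
    suc (suc n) ∸ suc n                    ≡⟨ cong (suc (suc n) ∸_) (sym new-bounce) ⟩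
    suc (suc n) ∸ nth (bounces w ∷ʳ suc n) (suc m) ∎
    where
    open ≡-Reasoning
    n = length w
    new-bounce : nth (bounces w ∷ʳ suc n) (suc m) ≡ suc n
    new-bounce = trans (cong (λ l → nth (bounces w ∷ʳ suc n) (suc l)) I.maxw≡)
                       (nth-∷ʳ-last (bounces w) (suc n))

Invariant-∷ʳ-climb : ∀ x r {a'} a → Invariant (x ∷ r) a' → lastBounce (x ∷ r) < a → a ≤ suc a' →
  Invariant ((x ∷ r) ∷ʳ a) a
Invariant-∷ʳ-climb x r a I β<a a≤ = record
  { area = ψ-∷ʳ-IsAreaSeq w a I.area (subst (1 ≤_) (sym I.length-Maxb≡) (s≤s z≤n))
  ; maxw≡ = trans E.maxw≡ (trans I.maxw≡ (cong length (sym bounces≡)))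
  ; length-Maxb≡ = trans E.length-Maxb≡ (cong suc (sym last≡))
  ; length-Maxa≡ = trans E.length-Maxa≡ (cong (a ∸_) (sym last≡))
  ; countGE≡ = countGE≡
  }
  where
  w = x ∷ r
  module I = Invariant I
  β = lastBounce w
  E : InsertionEffect (ψ w) (ψ (w ∷ʳ a)) (maxw (ψ w)) (suc (suc β)) (a ∸ suc β)
  E = InsertionEffect-cong (sym (ψ-∷ʳ w a)) refl refl
        (admissible-insert-high (ψ w) I.area I.length-Maxb≡ I.length-Maxa≡ β<a a≤)
  module E = InsertionEffect E
  last≡ : lastBounce (w ∷ʳ a) ≡ suc β
  last≡ = trans (lastBounce-∷ʳ x r a) (bounceStep-> β a β<a)
  bounces≡ : bounces (w ∷ʳ a) ≡ bounces w
  bounces≡ = bounces-∷ʳ-climb w a (λ b≡0 → 1+n≢0 (trans (sym last≡) b≡0))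
  countGE≡ : ∀ k → 1 ≤ k → k ≤ maxw (ψ (w ∷ʳ a)) →
    countGE k (ψ (w ∷ʳ a)) ≡ suc (length (w ∷ʳ a)) ∸ nth (bounces (w ∷ʳ a)) k
  countGE≡ k 1≤k k≤ rewrite bounces≡ | length-∷ʳ w a =
    countGE-old-levels I E ≤-refl k 1≤k (subst (k ≤_) E.maxw≡ k≤)

Invariant-∷ʳ : ∀ w {a'} a → Invariant w a' → a ≤ suc a' → Invariant (w ∷ʳ a) a
Invariant-∷ʳ [] a I _ = ⊥-elim (0≢1+n (Invariant.length-Maxb≡ I))
Invariant-∷ʳ (x ∷ r) a I a≤ with a ≤? lastBounce (x ∷ r)
... | yes a≤β = Invariant-∷ʳ-restart x r a I a≤β
... | no a≰β = Invariant-∷ʳ-climb x r a I (≰⇒> a≰β) a≤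

invariant : ∀ u a → IsAreaSeq (u ∷ʳ a) → Invariant (u ∷ʳ a) a
invariant u = go (reverseView u)
  where
  go : ∀ {u} → Reverse u → ∀ a → IsAreaSeq (u ∷ʳ a) → Invariant (u ∷ʳ a) a
  go [] _ (refl , _) = Invariant-[0]
  go (u' ∶ rev ∶ʳ a') a area =
    Invariant-∷ʳ (u' ∷ʳ a') a (go rev a' (IsAreaSeq-∷ʳ⁻ (u' ∷ʳ a') a area)) (IsAreaSeq-last u' a' a area)

lastBounce≡0⇔maxw-ψ-grows : ∀ u a → IsAreaSeq (u ∷ʳ a) → 1 ≤ length u →
  (lastBounce (u ∷ʳ a) ≡ 0) ⇔ (maxw (ψ (u ∷ʳ a)) ≡ maxw (ψ u) + 1)
lastBounce≡0⇔maxw-ψ-grows u a area 1≤u with reverseView u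
... | u' ∶ _ ∶ʳ a'
  rewrite Invariant.maxw≡ (invariant (u' ∷ʳ a') a area)
        | Invariant.maxw≡ (invariant u' a' (IsAreaSeq-∷ʳ⁻ (u' ∷ʳ a') a area))
  = lastBounce-∷ʳ≡0⇔ (u' ∷ʳ a') a 1≤u

proposition2p4 : (u : List ℕ) (a : ℕ) → IsAreaSeq (u ∷ʳ a) →
    ((1 ≤ length u) → ((nth (bounce (u ∷ʳ a)) (length (u ∷ʳ a)) ≡ 0) ⇔ (maxw (ψ (u ∷ʳ a)) ≡ maxw (ψ u) + 1)))
    × (length (bounces (u ∷ʳ a)) ≡ maxw (ψ (u ∷ʳ a)))
    × (length (Maxb (ψ (u ∷ʳ a))) ≡ nth (bounce (u ∷ʳ a)) (length (u ∷ʳ a)) + 1)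
    × (length (Maxa (ψ (u ∷ʳ a))) ≡ a ∸ nth (bounce (u ∷ʳ a)) (length (u ∷ʳ a)))
    × ((k : ℕ) → 1 ≤ k → k ≤ maxw (ψ (u ∷ʳ a)) →
        countGE k (ψ (u ∷ʳ a)) ≡ length (u ∷ʳ a) + 1 ∸ nth (bounces (u ∷ʳ a)) k)
proposition2p4 u a area =
  (λ 1≤u → subst (λ b → (b ≡ 0) ⇔ (maxw (ψ (u ∷ʳ a)) ≡ maxw (ψ u) + 1)) (sym last≡)
             (lastBounce≡0⇔maxw-ψ-grows u a area 1≤u))
  , sym maxw≡
  , trans length-Maxb≡ (trans (cong suc (sym last≡)) (+-comm 1 _))
  , trans length-Maxa≡ (cong (a ∸_) (sym last≡))
  , λ k 1≤k k≤ → trans (countGE≡ k 1≤k k≤)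
                        (cong (_∸ nth (bounces (u ∷ʳ a)) k) (+-comm 1 (length (u ∷ʳ a))))
  where
  open Invariant (invariant u a area) hiding (area)
  last≡ : nth (bounce (u ∷ʳ a)) (length (u ∷ʳ a)) ≡ lastBounce (u ∷ʳ a)
  last≡ = nth-bounce-length (u ∷ʳ a)
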